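{- For a nonnegative integer $d$, let $$p_k(m)=\prod_{i=0}^{k-1}(m+i+1-r),\qquad g_k(u,d)=\binom{d}{k}\prod_{i=0}^{k-1}(r+i)\prod_{j=k+1}^{d}(d-j+r)(u+j+r),$$ and $\mathbf{N}^u_d(m)=\sum_{k=0}^{d}g_k(u,d)p_k(m)$. Then $$(d+m)(u-m+2r)\,\mathbf{N}^{u}_d(m-1)=\sum_{k=0}^{d}\sum_{i=0}^{2}g_k(u,d)\,\gamma^{3,i}_k(u,d)\,p_{k+i}(m),$$ where $\gamma^{3,0}_k(u,d)=(d-k+r)(u+k+r)-(k+1)(u-d+2k+1)-(d-k)(k+r)$, $\gamma^{3,1}_k(u,d)=u-d+3k+3$, and $\gamma^{3,2}_k(u,d)=-1$.
   Context: $r,u,m$ are indeterminates (the identity is a polynomial identity in $r,u,m$); $d$ is a nonnegative integer. -}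

module Defs where

open import Algebra.Bundles using (CommutativeRing)
open import Data.Nat using (ℕ; zero; suc; _∸_) renaming (_+_ to _+ℕ_)
open import Data.Nat.Combinatorics using (_C_)

-- Everything is stated over an arbitrary commutative ring R; a polynomial
-- identity in the indeterminates r, u, m holds iff it holds for all
-- elements r, u, m of every commutative ring.
module Poly {c ℓ} (R : CommutativeRing c ℓ) where
  open CommutativeRing R

  ι : ℕ → Carrier
  ι zero    = 0#
  ι (suc n) = 1# + ι n

  prod : ℕ → (ℕ → Carrier) → Carrier
  prod zero    f = 1#
  prod (suc k) f = prod k f * f k

  sum : ℕ → (ℕ → Carrier) → Carrier
  sum zero    f = 0#
  sum (suc k) f = sum k f + f k

  -- ∏_{j=a}^{b} f j  (empty product when b < a)
  prodFromTo : ℕ → ℕ → (ℕ → Carrier) → Carrier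
  prodFromTo a b f = prod (suc b ∸ a) (λ t → f (a +ℕ t))

  p : (r : Carrier) → ℕ → Carrier → Carrier
  p r k m = prod k (λ i → ((m + ι i) + 1#) - r)

  g : (r u : Carrier) → ℕ → ℕ → Carrier
  g r u d k = (ι (d C k) * prod k (λ i → r + ι i))
            * prodFromTo (suc k) d (λ j → ((ι d - ι j) + r) * ((u + ι j) + r))

  N : (r u : Carrier) → ℕ → Carrier → Carrier
  N r u d m = sum (suc d) (λ k → g r u d k * p r k m)

  -- γ^{3,i}_k(u,d) for i = 0,1,2 (only these indices are ever used)
  γ3 : (r u : Carrier) → ℕ → ℕ → ℕ → Carrier
  γ3 r u d zero k =
      ((ι d - ι k) + r) * ((u + ι k) + r)
    - (ι (suc k) * (((u - ι d) + ι 2 * ι k) + 1#))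
    - ((ι d - ι k) * (ι k + r))
  γ3 r u d (suc zero) k = ((u - ι d) + ι 3 * ι k) + ι 3
  γ3 r u d (suc (suc zero)) k = - 1#
  γ3 r u d (suc (suc (suc _))) k = 0#

-- Multiply the k-th summand g_k p_k(m-1) of N(m-1) by (d+m)(u-m+2r).  Since
-- p_{k+1}(m-1) = (m-r) p_k(m), a polynomial identity turns this product into
-- the k-th summand of the right-hand side plus the remainder
-- (d-k)(k+r) g_k p_k(m), minus k(d-k+r)(u+k+r) g_k p_{k-1}(m).  By
-- (k+1) C(d,k+1) = (d-k) C(d,k) the subtracted term is the previous remainder,
-- so the sum telescopes, and the last remainder vanishes through its factor d-k.
module Submission where

open import Defs
open import Level using (Level)
open import Algebra.Bundles using (CommutativeRing)
open import Data.Nat using (ℕ; zero; suc; _∸_; _<_; _≤_) renaming (_+_ to _+ℕ_; _*_ to _*ℕ_)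
import Data.Nat.Properties as ℕₚ
open import Data.Nat.Combinatorics using (_C_; nC1≡n; nCk+nC[k+1]≡[n+1]C[k+1])
open import Data.Integer as ℤ using (ℤ; +_; -[1+_])
import Data.Integer.Properties as ℤₚ
import Data.Maybe as Maybe
open import Function using (_∘_)
open import Relation.Binary.Consequences using (dec⇒weaklyDec)
import Relation.Binary.PropositionalEquality as ≡
open import Algebra.Solver.Ring.AlmostCommutativeRing
  using (fromCommutativeRing; _-Raw-AlmostCommutative⟶_)

-- The standard library's natural-coefficient solver cannot normalise
-- subtraction, so we instantiate the ring solver with integer coefficients,
-- interpreted in R through the map ℤ → R.
module IntegerCoefficients {c ℓ} (R : CommutativeRing c ℓ) where
  open CommutativeRing R
  open import Algebra.Properties.Ring ring using (-0#≈0#; -‿involutive; -‿distribˡ-*; -‿distribʳ-*)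
  open import Algebra.Properties.AbelianGroup +-abelianGroup using (⁻¹-∙-comm)
  open import Algebra.Properties.Semiring.Mult.TCOptimised semiring
  open import Relation.Binary.Reasoning.Setoid setoid

  -- The optimised _×_ has 1 × x = x, so the coefficient + 1 denotes 1# itself.
  ⟦_⟧ : ℤ → Carrier
  ⟦ + n ⟧      = n × 1#
  ⟦ -[1+ n ] ⟧ = - (suc n × 1#)

  x-0#≈x : ∀ x → x - 0# ≈ x
  x-0#≈x x = trans (+-congˡ -0#≈0#) (+-identityʳ x)

  [x+y]-[x+z]≈y-z : ∀ x y z → (x + y) - (x + z) ≈ y - z
  [x+y]-[x+z]≈y-z x y z = begin
    (x + y) + - (x + z)   ≈⟨ +-congˡ (⁻¹-∙-comm x z) ⟨
    (x + y) + (- x + - z) ≈⟨ +-assoc x y (- x + - z) ⟩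
    x + (y + (- x + - z)) ≈⟨ +-congˡ (+-congˡ (+-comm (- x) (- z))) ⟩
    x + (y + (- z + - x)) ≈⟨ +-congˡ (+-assoc y (- z) (- x)) ⟨
    x + ((y - z) + - x)   ≈⟨ +-congˡ (+-comm (y - z) (- x)) ⟩
    x + (- x + (y - z))   ≈⟨ +-assoc x (- x) (y - z) ⟨
    (x - x) + (y - z)     ≈⟨ +-congʳ (-‿inverseʳ x) ⟩
    0# + (y - z)          ≈⟨ +-identityˡ (y - z) ⟩
    y - z                 ∎

  ⊖-homo : ∀ m n → ⟦ m ℤ.⊖ n ⟧ ≈ m × 1# - n × 1#
  ⊖-homo zero    zero    = sym (x-0#≈x 0#)
  ⊖-homo zero    (suc n) = sym (+-identityˡ _)
  ⊖-homo (suc m) zero    = sym (x-0#≈x _)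
  ⊖-homo (suc m) (suc n) rewrite ℤₚ.[1+m]⊖[1+n]≡m⊖n m n = begin
    ⟦ m ℤ.⊖ n ⟧                          ≈⟨ ⊖-homo m n ⟩
    m × 1# - n × 1#                      ≈⟨ [x+y]-[x+z]≈y-z 1# _ _ ⟨
    (1# + m × 1#) - (1# + n × 1#)        ≈⟨ +-cong (1+× m 1#) (-‿cong (1+× n 1#)) ⟨
    suc m × 1# - suc n × 1#              ∎

  +-homo : ∀ i j → ⟦ i ℤ.+ j ⟧ ≈ ⟦ i ⟧ + ⟦ j ⟧
  +-homo (+ m)    (+ n)    = ×-homo-+ 1# m n
  +-homo (+ m)    -[1+ n ] = ⊖-homo m (suc n)
  +-homo -[1+ m ] (+ n)    = trans (⊖-homo n (suc m)) (+-comm _ _)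
  +-homo -[1+ m ] -[1+ n ] = begin
    - (suc (suc (m +ℕ n)) × 1#)          ≈⟨ -‿cong (×-cong (ℕₚ.+-suc (suc m) n) refl) ⟨
    - ((suc m +ℕ suc n) × 1#)            ≈⟨ -‿cong (×-homo-+ 1# (suc m) (suc n)) ⟩
    - (suc m × 1# + suc n × 1#)          ≈⟨ ⁻¹-∙-comm _ _ ⟨
    - (suc m × 1#) + - (suc n × 1#)      ∎

  -‿homo : ∀ i → ⟦ ℤ.- i ⟧ ≈ - ⟦ i ⟧
  -‿homo (+ zero)  = sym -0#≈0#
  -‿homo (+ suc n) = refl
  -‿homo -[1+ n ]  = sym (-‿involutive _)

  *-homo : ∀ i j → ⟦ i ℤ.* j ⟧ ≈ ⟦ i ⟧ * ⟦ j ⟧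
  *-homo (+ m) (+ n) rewrite ℤₚ.+◃n≡+n (m *ℕ n) = ×1-homo-* m n
  *-homo (+ m) -[1+ n ] rewrite ℤₚ.-◃n≡-n (m *ℕ suc n) =
    trans (-‿homo (+ (m *ℕ suc n))) (trans (-‿cong (×1-homo-* m (suc n))) (-‿distribʳ-* _ _))
  *-homo -[1+ m ] (+ n) rewrite ℤₚ.-◃n≡-n (suc m *ℕ n) =
    trans (-‿homo (+ (suc m *ℕ n))) (trans (-‿cong (×1-homo-* (suc m) n)) (-‿distribˡ-* _ _))
  *-homo -[1+ m ] -[1+ n ] = begin
    (suc m *ℕ suc n) × 1#               ≈⟨ ×1-homo-* (suc m) (suc n) ⟩
    a * b                                ≈⟨ -‿involutive _ ⟨
    - - (a * b)                          ≈⟨ -‿cong (-‿distribʳ-* a b) ⟩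
    - (a * - b)                          ≈⟨ -‿distribˡ-* a (- b) ⟩
    - a * - b                            ∎
    where a = suc m × 1#; b = suc n × 1#

  ℤ⟶R : ℤ.+-*-rawRing -Raw-AlmostCommutative⟶ fromCommutativeRing R
  ℤ⟶R = record
    { ⟦_⟧    = ⟦_⟧
    ; +-homo = +-homo
    ; *-homo = *-homo
    ; -‿homo = -‿homo
    ; 0-homo = refl
    ; 1-homo = refl
    }

  ⟦⟧-weaklyDec : ∀ i j → Maybe.Maybe (⟦ i ⟧ ≈ ⟦ j ⟧)
  ⟦⟧-weaklyDec i j = Maybe.map (reflexive ∘ ≡.cong ⟦_⟧) (dec⇒weaklyDec ℤ._≟_ i j)

  open import Algebra.Solver.Ring ℤ.+-*-rawRing (fromCommutativeRing R) ℤ⟶R ⟦⟧-weaklyDec public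
    using (Polynomial; con; _:+_; _:*_; _:-_; :-_; _:=_; solve)

module PolyProperties {c ℓ} (R : CommutativeRing c ℓ) where
  open CommutativeRing R
  open Poly R
  open IntegerCoefficients R
  open import Relation.Binary.Reasoning.Setoid setoid

  0ₚ 1ₚ : ∀ {n} → Polynomial n
  0ₚ = con (+ 0)
  1ₚ = con (+ 1)

  -- Solver syntax denoting ι k on the nose (con (+ k) would not), so that
  -- instances of `solve … refl` match the definitions of Defs by conversion.
  ιₚ : ∀ {n} → ℕ → Polynomial n
  ιₚ zero    = 0ₚ
  ιₚ (suc k) = 1ₚ :+ ιₚ k

  ι-+ : ∀ a b → ι (a +ℕ b) ≈ ι a + ι b
  ι-+ zero    b = sym (+-identityˡ _)
  ι-+ (suc a) b = trans (+-congˡ (ι-+ a b)) (sym (+-assoc _ _ _))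

  sum-cong : ∀ n {f f′} → (∀ i → f i ≈ f′ i) → sum n f ≈ sum n f′
  sum-cong zero    f≈f′ = refl
  sum-cong (suc n) f≈f′ = +-cong (sum-cong n f≈f′) (f≈f′ n)

  prod-cong : ∀ n {f f′} → (∀ i → f i ≈ f′ i) → prod n f ≈ prod n f′
  prod-cong zero    f≈f′ = refl
  prod-cong (suc n) f≈f′ = *-cong (prod-cong n f≈f′) (f≈f′ n)

  *-distribˡ-sum : ∀ x n f → x * sum n f ≈ sum n (λ i → x * f i)
  *-distribˡ-sum x zero    f = zeroʳ x
  *-distribˡ-sum x (suc n) f = trans (distribˡ x _ _) (+-congʳ (*-distribˡ-sum x n f))

  prod-unfoldˡ : ∀ n f → prod (suc n) f ≈ f 0 * prod n (f ∘ suc)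
  prod-unfoldˡ zero    f = *-comm 1# (f 0)
  prod-unfoldˡ (suc n) f = trans (*-congʳ (prod-unfoldˡ n f)) (*-assoc _ _ _)

  prodFromTo-unfoldˡ : ∀ {a b} f → a ≤ b → prodFromTo a b f ≈ f a * prodFromTo (suc a) b f
  prodFromTo-unfoldˡ {a} {b} f a≤b = begin
    prod (suc b ∸ a) (λ t → f (a +ℕ t))
      ≡⟨ ≡.cong (λ n → prod n (λ t → f (a +ℕ t))) (ℕₚ.+-∸-assoc 1 a≤b) ⟩
    prod (suc (b ∸ a)) (λ t → f (a +ℕ t))
      ≈⟨ prod-unfoldˡ (b ∸ a) _ ⟩
    f (a +ℕ 0) * prod (b ∸ a) (λ t → f (a +ℕ suc t))
      ≈⟨ *-cong (reflexive (≡.cong f (ℕₚ.+-identityʳ a)))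
                (prod-cong (b ∸ a) (λ t → reflexive (≡.cong f (ℕₚ.+-suc a t)))) ⟩
    f a * prod (b ∸ a) (λ t → f (suc a +ℕ t)) ∎

  sum-telescope : ∀ (x e f : ℕ → Carrier) n → x 0 ≈ e 0 + f 0 →
                  (∀ k → k < n → x (suc k) + f k ≈ e (suc k) + f (suc k)) →
                  sum (suc n) x ≈ sum (suc n) e + f n
  sum-telescope x e f zero    base step = begin
    0# + x 0          ≈⟨ +-identityˡ (x 0) ⟩
    x 0               ≈⟨ base ⟩
    e 0 + f 0         ≈⟨ +-congʳ (+-identityˡ (e 0)) ⟨
    (0# + e 0) + f 0  ∎
  sum-telescope x e f (suc n) base step = begin
    sum (suc n) x + x (suc n)               ≈⟨ +-congʳ (sum-telescope x e f n base (λ k → step k ∘ ℕₚ.m<n⇒m<1+n)) ⟩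
    (sum (suc n) e + f n) + x (suc n)       ≈⟨ +-assoc _ _ _ ⟩
    sum (suc n) e + (f n + x (suc n))       ≈⟨ +-congˡ (+-comm (f n) (x (suc n))) ⟩
    sum (suc n) e + (x (suc n) + f n)       ≈⟨ +-congˡ (step n ℕₚ.≤-refl) ⟩
    sum (suc n) e + (e (suc n) + f (suc n)) ≈⟨ +-assoc _ _ _ ⟨
    sum (suc (suc n)) e + f (suc n)         ∎

  [k+1]*nC[k+1]≈[n-k]*nCk : ∀ n k → ι (suc k) * ι (n C suc k) ≈ (ι n - ι k) * ι (n C k)
  [k+1]*nC[k+1]≈[n-k]*nCk zero zero = trans (zeroʳ _) (sym (trans (*-congʳ (-‿inverseʳ 0#)) (zeroˡ _)))
  [k+1]*nC[k+1]≈[n-k]*nCk zero (suc k) = trans (zeroʳ _) (sym (zeroʳ _))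
  [k+1]*nC[k+1]≈[n-k]*nCk (suc n) zero rewrite nC1≡n (suc n) =
    solve 1 (λ N → ιₚ 1 :* N := (N :- ιₚ 0) :* ιₚ 1) refl (ι (suc n))
  [k+1]*nC[k+1]≈[n-k]*nCk (suc n) (suc k)
    rewrite ≡.sym (nCk+nC[k+1]≡[n+1]C[k+1] n (suc k))
          | ≡.sym (nCk+nC[k+1]≡[n+1]C[k+1] n k) = begin
    ι (2 +ℕ k) * ι (b +ℕ b′)                  ≈⟨ *-congˡ (ι-+ b b′) ⟩
    ι (2 +ℕ k) * (ι b + ι b′)                 ≈⟨ distribˡ _ _ _ ⟩
    ι (2 +ℕ k) * ι b + ι (2 +ℕ k) * ι b′     ≈⟨ +-congˡ ([k+1]*nC[k+1]≈[n-k]*nCk n (suc k)) ⟩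
    ι (2 +ℕ k) * ι b + (ι n - ι (suc k)) * ι b
      ≈⟨ solve 3 (λ K N B → (1ₚ :+ (1ₚ :+ K)) :* B :+ (N :- (1ₚ :+ K)) :* B := (1ₚ :+ K) :* B :+ (N :- K) :* B)
                 refl (ι k) (ι n) (ι b) ⟩
    ι (suc k) * ι b + (ι n - ι k) * ι b      ≈⟨ +-congʳ ([k+1]*nC[k+1]≈[n-k]*nCk n k) ⟩
    (ι n - ι k) * ι a + (ι n - ι k) * ι b
      ≈⟨ solve 4 (λ K N A B → (N :- K) :* A :+ (N :- K) :* B := ((1ₚ :+ N) :- (1ₚ :+ K)) :* (A :+ B))
                 refl (ι k) (ι n) (ι a) (ι b) ⟩
    (ι (suc n) - ι (suc k)) * (ι a + ι b)    ≈⟨ *-congˡ (ι-+ a b) ⟨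
    (ι (suc n) - ι (suc k)) * ι (a +ℕ b)     ∎
    where a = n C k; b = n C suc k; b′ = n C suc (suc k)

  p-pred : ∀ r m k → p r (suc k) (m - 1#) ≈ (m - r) * p r k m
  p-pred r m k = begin
    p r (suc k) (m - 1#)
      ≈⟨ prod-unfoldˡ k _ ⟩
    ((((m - 1#) + 0#) + 1#) - r) * prod k (λ i → (((m - 1#) + ι (suc i)) + 1#) - r)
      ≈⟨ *-cong (solve 2 (λ M Rr → (((M :- 1ₚ) :+ 0ₚ) :+ 1ₚ) :- Rr := M :- Rr) refl m r)
                (prod-cong k λ i → solve 3 (λ M I Rr → (((M :- 1ₚ) :+ (1ₚ :+ I)) :+ 1ₚ) :- Rr
                                                  := ((M :+ I) :+ 1ₚ) :- Rr) refl m (ι i) r) ⟩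
    (m - r) * p r k m ∎

  module Summands (r u m : Carrier) (d : ℕ) where

    h : ℕ → Carrier
    h j = ((ι d - ι j) + r) * ((u + ι j) + r)

    A : Carrier
    A = (ι d + m) * ((u - m) + ι 2 * r)

    -- rhs-summand uses p_{i+k} rather than p_{k+i}: for i = 0, 1, 2 it then
    -- unfolds to the product form that the solver calls below expect.
    lhs-summand rhs-summand remainder : ℕ → Carrier
    lhs-summand k = A * (g r u d k * p r k (m - 1#))
    rhs-summand k = sum 3 (λ i → (g r u d k * γ3 r u d i k) * p r (i +ℕ k) m)
    remainder   k = (((ι d - ι k) * (ι k + r)) * g r u d k) * p r k m

    g-step : ∀ k → k < d →
             (ι (suc k) * h (suc k)) * g r u d (suc k) ≈ ((ι d - ι k) * (ι k + r)) * g r u d k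
    g-step k k<d = begin
      (K′ * H) * ((B′ * (Rk * (r + K))) * Q′)
        ≈⟨ solve 7 (λ K′ H B′ Rk Rr K Q′ → (K′ :* H) :* ((B′ :* (Rk :* (Rr :+ K))) :* Q′)
                                       := (K′ :* B′) :* ((Rk :* (Rr :+ K)) :* (H :* Q′)))
                   refl K′ H B′ Rk r K Q′ ⟩
      (K′ * B′) * ((Rk * (r + K)) * (H * Q′))
        ≈⟨ *-congʳ ([k+1]*nC[k+1]≈[n-k]*nCk d k) ⟩
      ((ι d - K) * B) * ((Rk * (r + K)) * (H * Q′))
        ≈⟨ solve 7 (λ D K B Rk Rr H Q′ → ((D :- K) :* B) :* ((Rk :* (Rr :+ K)) :* (H :* Q′))
                                      := ((D :- K) :* (K :+ Rr)) :* ((B :* Rk) :* (H :* Q′)))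
                   refl (ι d) K B Rk r H Q′ ⟩
      ((ι d - K) * (K + r)) * ((B * Rk) * (H * Q′))
        ≈⟨ *-congˡ (*-congˡ (prodFromTo-unfoldˡ h k<d)) ⟨
      ((ι d - K) * (K + r)) * ((B * Rk) * prodFromTo (suc k) d h) ∎
      where
      K = ι k; K′ = ι (suc k); H = h (suc k)
      B = ι (d C k); B′ = ι (d C suc k)
      Rk = prod k (λ i → r + ι i)
      Q′ = prodFromTo (suc (suc k)) d h

    fₚ : ∀ {n} → (M K Rr : Polynomial n) → Polynomial n
    fₚ M K Rr = ((M :+ K) :+ 1ₚ) :- Rr

    Aₚ : ∀ {n} → (D M U Rr : Polynomial n) → Polynomial n
    Aₚ D M U Rr = (D :+ M) :* ((U :- M) :+ ιₚ 2 :* Rr)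

    rhs-summandₚ : ∀ {n} → (D U Rr G K P₀ P₁ P₂ : Polynomial n) → Polynomial n
    rhs-summandₚ D U Rr G K P₀ P₁ P₂ =
      ((0ₚ :+ (G :* γ₀) :* P₀) :+ (G :* γ₁) :* P₁) :+ (G :* :- 1ₚ) :* P₂
      where
      γ₀ = (((D :- K) :+ Rr) :* ((U :+ K) :+ Rr) :- ((1ₚ :+ K) :* (((U :- D) :+ ιₚ 2 :* K) :+ 1ₚ)))
           :- ((D :- K) :* (K :+ Rr))
      γ₁ = ((U :- D) :+ ιₚ 3 :* K) :+ ιₚ 3

    remainderₚ : ∀ {n} → (D K Rr G P : Polynomial n) → Polynomial n
    remainderₚ D K Rr G P = (((D :- K) :* (K :+ Rr)) :* G) :* P

    lhs≈rhs+remainder-zero : lhs-summand 0 ≈ rhs-summand 0 + remainder 0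
    lhs≈rhs+remainder-zero =
      solve 5 (λ D M U Rr G →
                 Aₚ D M U Rr :* (G :* 1ₚ)
              := rhs-summandₚ D U Rr G 0ₚ 1ₚ (1ₚ :* fₚ M 0ₚ Rr) ((1ₚ :* fₚ M 0ₚ Rr) :* fₚ M (ιₚ 1) Rr)
                 :+ remainderₚ D 0ₚ Rr G 1ₚ)
            refl (ι d) m u r (g r u d 0)

    lhs+carry≈rhs+remainder-suc :
      ∀ j → lhs-summand (suc j) + ((ι (suc j) * h (suc j)) * g r u d (suc j)) * p r j m
            ≈ rhs-summand (suc j) + remainder (suc j)
    lhs+carry≈rhs+remainder-suc j = begin
      A * (g r u d (suc j) * p r (suc j) (m - 1#)) + carry
        ≈⟨ +-congʳ (*-congˡ (*-congˡ (p-pred r m j))) ⟩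
      A * (g r u d (suc j) * ((m - r) * p r j m)) + carry
        ≈⟨ solve 7 (λ D J M U Rr G P →
                        Aₚ D M U Rr :* (G :* ((M :- Rr) :* P))
                        :+ ((K J :* (((D :- K J) :+ Rr) :* ((U :+ K J) :+ Rr))) :* G) :* P
                     := rhs-summandₚ D U Rr G (K J) (P :* fₚ M J Rr) ((P :* fₚ M J Rr) :* fₚ M (K J) Rr)
                          (((P :* fₚ M J Rr) :* fₚ M (K J) Rr) :* fₚ M (K (K J)) Rr)
                        :+ remainderₚ D (K J) Rr G (P :* fₚ M J Rr))
                   refl (ι d) (ι j) m u r (g r u d (suc j)) (p r j m) ⟩
      rhs-summand (suc j) + remainder (suc j) ∎
      where
      carry = ((ι (suc j) * h (suc j)) * g r u d (suc j)) * p r j m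
      K : ∀ {n} → Polynomial n → Polynomial n
      K J = 1ₚ :+ J

    remainder-top≈0 : remainder d ≈ 0#
    remainder-top≈0 = begin
      (((ι d - ι d) * (ι d + r)) * g r u d d) * p r d m ≈⟨ *-congʳ (*-congʳ (*-congʳ (-‿inverseʳ (ι d)))) ⟩
      ((0# * (ι d + r)) * g r u d d) * p r d m         ≈⟨ *-congʳ (*-congʳ (zeroˡ _)) ⟩
      (0# * g r u d d) * p r d m                       ≈⟨ *-congʳ (zeroˡ _) ⟩
      0# * p r d m                                     ≈⟨ zeroˡ _ ⟩
      0#                                               ∎

    lhs+remainder≈rhs+remainder : ∀ k → k < d →
      lhs-summand (suc k) + remainder k ≈ rhs-summand (suc k) + remainder (suc k)
    lhs+remainder≈rhs+remainder k k<d =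
      trans (+-congˡ (*-congʳ (sym (g-step k k<d)))) (lhs+carry≈rhs+remainder-suc k)

    rhs-summand-reindex : ∀ k → rhs-summand k ≈ sum 3 (λ i → (g r u d k * γ3 r u d i k) * p r (k +ℕ i) m)
    rhs-summand-reindex k =
      sum-cong 3 (λ i → reflexive (≡.cong (λ n → (g r u d k * γ3 r u d i k) * p r n m) (ℕₚ.+-comm i k)))

proposition5p6 : ∀ {c ℓ : Level} (R : CommutativeRing c ℓ) →
    let open CommutativeRing R
        open Poly R
    in ∀ (r u m : Carrier) (d : ℕ) →
      ((ι d + m) * ((u - m) + ι 2 * r)) * N r u d (m - 1#)
        ≈ sum (suc d) (λ k → sum 3 (λ i → (g r u d k * γ3 r u d i k) * p r (k +ℕ i) m))
proposition5p6 R r u m d = begin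
  A * N r u d (m - 1#)                         ≈⟨ *-distribˡ-sum A (suc d) _ ⟩
  sum (suc d) lhs-summand                      ≈⟨ sum-telescope lhs-summand rhs-summand remainder d
                                                    lhs≈rhs+remainder-zero lhs+remainder≈rhs+remainder ⟩
  sum (suc d) rhs-summand + remainder d        ≈⟨ +-congˡ remainder-top≈0 ⟩
  sum (suc d) rhs-summand + 0#                 ≈⟨ +-identityʳ _ ⟩
  sum (suc d) rhs-summand                      ≈⟨ sum-cong (suc d) rhs-summand-reindex ⟩
  sum (suc d) (λ k → sum 3 (λ i → (g r u d k * γ3 r u d i k) * p r (k +ℕ i) m)) ∎
  where
  open CommutativeRing R
  open Poly R
  open PolyProperties R
  open Summands r u m d
  open import Relation.Binary.Reasoning.Setoid setoid
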